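{- Let $n\ge3$ and $t\ge1$ be integers, $N=n^t$, and fix an instruction set generator $(\Delta_n^i)_{2\le i\le N}$ used for every column. Let $O'=(\sigma_i^j)$ be a weak order-generator for $V(K_n^t)$ and $O=\Phi(O')=(v^1,\dots,v^N)$. Then $O$ is an ordering of $V(K_n^t)$ that induces a consecutive radio labeling if and only if $O$ has no repeated rows and, for every $1<i\le N$ and every integer $1\le s<t$ with $i-s\ge1$, at most $s-1$ indices $j\in\{1,\dots,t\}$ satisfy $\sigma_{i-s+1}^j\cdots\sigma_i^j\in\Lambda_s^{i-s+1}(\sigma_1^j,\dots,\sigma_{i-s}^j)$.
   Context: $S_n$ is the symmetric group on $\{1,\dots,n\}$, with $\sigma\tau=\tau\circ\sigma$. An instruction set is $\{f_2,\dots,f_n\}\subset S_n$ ($n-1$ elements) with $f_k(k)=1$. An instruction set generator is a family of functions $\Delta_n^i:S_n^{i-1}\to\mathcal{P}(S_n)$, $2\le i\le N$, each value an instruction set. $V(K_n)=\{v_1,\dots,v_n\}$; vertices of $K_n^t$ (Cartesian power) are $t$-tuples over $V(K_n)$, distance is the number of differing coordinates, diameter $t$. $S_n$ acts on $n$-tuples of distinct elements of $V(K_n)$ by $\sigma\cdot(v_{s_1},\dots,v_{s_n})=(v_{s_{\sigma^{ -1}(1)}},\dots,v_{s_{\sigma^{ -1}(n)}})$. For a column $(\sigma_1,\dots,\sigma_N)$ with $\sigma_1=\mathrm{id}$, $\sigma_2=f_2\in\Delta_n^2(\mathrm{id})$, $\sigma_i\in\Delta_n^i(\sigma_1,\dots,\sigma_{i-1})$,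 set $o_1=(v_1,\dots,v_n)$, $o_i=\sigma_i\cdot o_{i-1}$ and let $\phi_n$ of the column be the column of first coordinates of the $o_i$. A weak order-generator is an $N\times t$ matrix each of whose columns is such a column; $\Phi(O')$ applies $\phi_n$ to every column, producing a matrix whose rows are vertices of $K_n^t$. $\Lambda_s^i(\rho_1,\dots,\rho_{i-1})$ is the set of products $\tau_1\cdots\tau_s$ with $\tau_k\in\Delta_n^{i+k-1}(\rho_1,\dots,\rho_{i-1},\tau_1,\dots,\tau_{k-1})$ and $\tau_1\cdots\tau_s(1)=1$. An ordering is a list of all vertices without repetition; a radio labeling is $f:V\to\mathbb{Z}^+$ with $|f(u)-f(v)|\ge t+1-d(u,v)$ for distinct $u,v$, consecutive if bijective onto $\{1,\dots,N\}$; the induced labeling of $(v^1,\dots,v^N)$ is $f(v^1)=1$, $f(v^i)=\min\{x\in\mathbb{Z}:x>f(v^{i-1}),\ |x-f(v^l)|\ge t+1-d(v^i,v^l)\ \forall l<i\}$. -}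

module Defs where

open import Data.Nat using (ℕ; zero; suc; _+_; _∸_; _≤_; _<_; ∣_-_∣)
open import Data.Fin using (Fin; zero; suc; _≟_)
open import Data.Fin.Permutation using (Permutation′; _⟨$⟩ʳ_; _⟨$⟩ˡ_; _∘ₚ_; _≈_)
  renaming (id to idₚ)
open import Data.Fin.Subset using (Subset; _∈_; ∣_∣)
open import Data.Vec using (Vec; tabulate; []) renaming (_∷_ to _∷ᵥ_)
open import Relation.Nullary using (yes; no)
open import Data.Unit using (⊤)
open import Data.List using (List; []; _∷_; _++_; [_]; length)
open import Data.List.Relation.Binary.Pointwise using (Pointwise)
open import Data.Product using (Σ; ∃; _×_)
open import Relation.Binary.PropositionalEquality using (_≡_; _≢_)

-- Elements of S_n are permutations of Fin n; index "zero : Fin n" is the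
-- paper's 1, "suc k" is the paper's k+2, etc.
-- Products: στ = τ ∘ σ, which is exactly stdlib's  σ ∘ₚ τ  (σ applied first).

Perm : ℕ → Set
Perm = Permutation′

-- Instruction set {f_2,…,f_n} ⊂ S_n with f_k(k) = 1, for n = suc m.
-- f k  (k : Fin m) is the paper's f_{k+2}; it must send  suc k  to  zero.
record InstrSet (m : ℕ) : Set where
  field
    f   : Fin m → Perm (suc m)
    f-k : ∀ k → f k ⟨$⟩ʳ suc k ≡ zero
open InstrSet public

f₂ : ∀ {m} → InstrSet (suc m) → Perm (suc (suc m))
f₂ I = f I zero

_∈I_ : ∀ {m} → Perm (suc m) → InstrSet m → Set
σ ∈I I = ∃ λ k → σ ≈ f I k

-- Instruction set generator: Δ ρs is Δ_n^i(ρ_1,…,ρ_{i-1}) where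
-- ρs = ρ_1 ∷ … ∷ ρ_{i-1} ∷ [] (so i = length ρs + 1).
-- Values for i > N are never used.
Generator : ℕ → Set
Generator m = List (Perm (suc m)) → InstrSet m

-- Since elements of S_n are represented by records, we require Δ to be a
-- genuine function on S_n^{i-1}, i.e. to respect extensional equality.
RespectsExt : ∀ {m} → Generator m → Set
RespectsExt {m} Δ = ∀ {ρs ρs′ : List (Perm (suc m))} →
  Pointwise _≈_ ρs ρs′ → ∀ k → f (Δ ρs) k ≈ f (Δ ρs′) k

prod : ∀ {n} → List (Perm n) → Perm n
prod []       = idₚ
prod (τ ∷ τs) = τ ∘ₚ prod τs

Chain : ∀ {m} → Generator m → List (Perm (suc m)) → List (Perm (suc m)) → Set
Chain Δ ρs []       = ⊤
Chain Δ ρs (τ ∷ τs) = (τ ∈I Δ ρs) × Chain Δ (ρs ++ [ τ ]) τs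

InΛ : ∀ {m} → Generator m → ℕ → List (Perm (suc m)) → Perm (suc m) → Set
InΛ {m} Δ s ρs π = Σ (List (Perm (suc m))) λ τs →
  length τs ≡ s × Chain Δ ρs τs × π ≈ prod τs × prod τs ⟨$⟩ʳ zero ≡ zero

-- A column is σ : ℕ → S_n with σ i the paper's σ_i (1-based; only
-- 1 ≤ i ≤ N matter).
-- prefix σ k = (σ_1, …, σ_k)
prefix : ∀ {n} → (ℕ → Perm n) → ℕ → List (Perm n)
prefix σ zero    = []
prefix σ (suc k) = prefix σ k ++ [ σ (suc k) ]

segment : ∀ {n} → (ℕ → Perm n) → ℕ → ℕ → List (Perm n)
segment σ a zero    = []
segment σ a (suc s) = σ a ∷ segment σ (suc a) s

IsColumn : ∀ {m} → Generator (suc m) → ℕ → (ℕ → Perm (suc (suc m))) → Set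
IsColumn Δ N σ =
  (σ 1 ≈ idₚ) × (σ 2 ≈ f₂ (Δ (prefix σ 1))) ×
  (∀ i → 3 ≤ i → i ≤ N → σ i ∈I Δ (prefix σ (i ∸ 1)))

-- action σ·(v_{s_1},…,v_{s_n}) = (v_{s_{σ⁻¹(1)}},…,v_{s_{σ⁻¹(n)}}),
-- tuples of distinct vertices encoded by their index maps s : Fin n → Fin n
act : ∀ {n} → Perm n → (Fin n → Fin n) → (Fin n → Fin n)
act σ s k = s (σ ⟨$⟩ˡ k)

-- o_i for a column (o_1 = (v_1,…,v_n); o_i = σ_i · o_{i-1}); index 0 unused
orbit : ∀ {n} → (ℕ → Perm n) → ℕ → (Fin n → Fin n)
orbit σ zero          = λ k → k
orbit σ (suc zero)    = λ k → k
orbit σ (suc (suc i)) = act (σ (suc (suc i))) (orbit σ (suc i))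

φ : ∀ {n} → (ℕ → Perm (suc n)) → ℕ → Fin (suc n)
φ σ i = orbit σ i zero

Vertex : ℕ → ℕ → Set
Vertex n t = Vec (Fin n) t

dist : ∀ {n t} → Vertex n t → Vertex n t → ℕ
dist []       []       = 0
dist (x ∷ᵥ xs) (y ∷ᵥ ys) with x ≟ y
... | yes _ = dist xs ys
... | no _  = suc (dist xs ys)

-- Φ(O'): O' j is column j (j : Fin t); row i is the vertex v^i
Φrow : ∀ {n t} → (Fin t → ℕ → Perm (suc n)) → ℕ → Vertex (suc n) t
Φrow O′ i = tabulate λ j → φ (O′ j) i

NoRepeatedRows : ∀ {n t} → ℕ → (ℕ → Vertex n t) → Set
NoRepeatedRows N v = ∀ i l → 1 ≤ i → i ≤ N → 1 ≤ l → l ≤ N → v i ≡ v l → i ≡ l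

IsOrdering : ∀ {n t} → ℕ → (ℕ → Vertex n t) → Set
IsOrdering {n} {t} N v = NoRepeatedRows N v ×
  (∀ (w : Vertex n t) → ∃ λ i → 1 ≤ i × i ≤ N × v i ≡ w)

-- L is the labeling induced by the ordering (L i = f(v^i))
IsInduced : ∀ {n t} → ℕ → (ℕ → Vertex n t) → (ℕ → ℕ) → Set
IsInduced {n} {t} N v L = (L 1 ≡ 1) ×
  (∀ i → 2 ≤ i → i ≤ N →
     L (i ∸ 1) < L i × Ok i (L i) ×
     (∀ x → L (i ∸ 1) < x → Ok i x → L i ≤ x))
  where
  Ok : ℕ → ℕ → Set
  Ok i x = ∀ l → 1 ≤ l → l < i → suc t ∸ dist (v i) (v l) ≤ ∣ x - L l ∣

IsRadio : ∀ {n t} → ℕ → (ℕ → Vertex n t) → (ℕ → ℕ) → Set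
IsRadio {n} {t} N v L = ∀ i l → 1 ≤ i → i ≤ N → 1 ≤ l → l ≤ N →
  v i ≢ v l →
  suc t ∸ dist (v i) (v l) ≤ ∣ L i - L l ∣

IsConsecutive : ℕ → (ℕ → ℕ) → Set
IsConsecutive N L =
  (∀ i → 1 ≤ i → i ≤ N → 1 ≤ L i × L i ≤ N) ×
  (∀ i l → 1 ≤ i → i ≤ N → 1 ≤ l → l ≤ N → L i ≡ L l → i ≡ l) ×
  (∀ x → 1 ≤ x → x ≤ N → ∃ λ i → 1 ≤ i × i ≤ N × L i ≡ x)

InducesConsecutiveRadio : ∀ {n t} → ℕ → (ℕ → Vertex n t) → Set
InducesConsecutiveRadio N v = ∃ λ L →
  IsInduced N v L × IsRadio N v L × IsConsecutive N L

AtMost : ∀ {t} → ℕ → (Fin t → Set) → Set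
AtMost {t} k P = ∀ (S : Subset t) → (∀ j → j ∈ S → P j) → ∣ S ∣ ≤ k

-- Labelling the ordering by position, L(v^i) = i, is the only candidate for a
-- consecutive induced labeling, so both sides amount to the radio condition
-- t + 1 − d(v^i, v^l) ≤ i − l for l < i. Write s = i − l. For s ≥ t it holds as
-- soon as the rows differ. For s < t, since d(v^i, v^l) = t − #(agreeing
-- columns), it says that at most s − 1 columns have equal entries in rows i and
-- l. In column j that entry is the first coordinate of o_i = π·o_l with
-- π = σ_{l+1}⋯σ_i, so the entries agree iff π fixes 1, i.e. iff π ∈ Λ_s^{l+1}.
module Submission where

open import Defs
open import Data.Nat using (ℕ; zero; suc; _^_; _∸_; _≤_; _<_; _+_; z≤n; s≤s; s≤s⁻¹; ∣_-_∣; _<?_)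
open import Data.Nat.Properties hiding (_≟_)
open import Data.Fin using (Fin; zero; suc; toℕ; combine; _≟_)
open import Data.Fin.Properties using (toℕ-injective; toℕ<n; combine-injective; pigeonhole)
open import Data.Fin.Permutation using (_⟨$⟩ʳ_; _⟨$⟩ˡ_; inverseˡ; inverseʳ)
open import Data.Fin.Subset using (Subset; inside; outside) renaming (_∈_ to _∈S_; ∣_∣ to ∣_∣S)
open import Data.Fin.Subset.Properties using (p⊆q⇒∣p∣≤∣q∣)
open import Data.Vec using ([]; _∷_; tabulate; here; there)
open import Data.List using (length)
open import Data.Product using (∃; _×_; _,_; proj₁; proj₂)
open import Data.Unit using (tt)
open import Data.Empty using (⊥-elim)
open import Function using (_∘_)
open import Function.Bundles using (_⇔_; mk⇔; Equivalence)
open import Function.Properties.Equivalence using () renaming (sym to ⇔-sym; trans to ⇔-trans)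
open import Relation.Binary.Definitions using (tri<; tri≈; tri>)
open import Relation.Nullary using (yes; no)
open import Relation.Binary.PropositionalEquality

open Equivalence using (to; from)

dist-sym : ∀ {n t} (x y : Vertex n t) → dist x y ≡ dist y x
dist-sym [] [] = refl
dist-sym (x ∷ xs) (y ∷ ys) with x ≟ y | y ≟ x
... | yes _   | yes _   = dist-sym xs ys
... | yes x≡y | no y≢x  = ⊥-elim (y≢x (sym x≡y))
... | no x≢y  | yes y≡x = ⊥-elim (x≢y (sym y≡x))
... | no _    | no _    = cong suc (dist-sym xs ys)

dist≡0⇒≡ : ∀ {n t} (x y : Vertex n t) → dist x y ≡ 0 → x ≡ y
dist≡0⇒≡ [] [] _ = refl
dist≡0⇒≡ (x ∷ xs) (y ∷ ys) d≡0 with x ≟ y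
... | yes x≡y = cong₂ _∷_ x≡y (dist≡0⇒≡ xs ys d≡0)

agreement : ∀ {n t} → (Fin t → Fin n) → (Fin t → Fin n) → Subset t
agreement {t = zero}  g h = []
agreement {t = suc t} g h with g zero ≟ h zero
... | yes _ = inside  ∷ agreement (g ∘ suc) (h ∘ suc)
... | no _  = outside ∷ agreement (g ∘ suc) (h ∘ suc)

dist+∣agreement∣≡t : ∀ {n t} (g h : Fin t → Fin n) →
  dist (tabulate g) (tabulate h) + ∣ agreement g h ∣S ≡ t
dist+∣agreement∣≡t {t = zero}  g h = refl
dist+∣agreement∣≡t {t = suc t} g h with g zero ≟ h zero
... | yes _ = trans (+-suc _ _) (cong suc (dist+∣agreement∣≡t (g ∘ suc) (h ∘ suc)))
... | no _  = cong suc (dist+∣agreement∣≡t (g ∘ suc) (h ∘ suc))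

∈agreement⇒≡ : ∀ {n t} (g h : Fin t → Fin n) j → j ∈S agreement g h → g j ≡ h j
∈agreement⇒≡ g h zero j∈A with g zero ≟ h zero | j∈A
... | yes g₀≡h₀ | here = g₀≡h₀
∈agreement⇒≡ g h (suc j) j∈A with g zero ≟ h zero | j∈A
... | yes _ | there j∈A = ∈agreement⇒≡ (g ∘ suc) (h ∘ suc) j j∈A
... | no _  | there j∈A = ∈agreement⇒≡ (g ∘ suc) (h ∘ suc) j j∈A

≡⇒∈agreement : ∀ {n t} (g h : Fin t → Fin n) j → g j ≡ h j → j ∈S agreement g h
≡⇒∈agreement g h zero g₀≡h₀ with g zero ≟ h zero
... | yes _    = here
... | no g₀≢h₀ = ⊥-elim (g₀≢h₀ g₀≡h₀)
≡⇒∈agreement g h (suc j) gj≡hj with g zero ≟ h zero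
... | yes _ = there (≡⇒∈agreement (g ∘ suc) (h ∘ suc) j gj≡hj)
... | no _  = there (≡⇒∈agreement (g ∘ suc) (h ∘ suc) j gj≡hj)

atMost⇔∣∣≤ : ∀ {t k} {P : Fin t → Set} (A : Subset t) →
  (∀ j → P j ⇔ j ∈S A) → AtMost k P ⇔ ∣ A ∣S ≤ k
atMost⇔∣∣≤ A P⇔∈A = mk⇔
  (λ atMost → atMost A (λ j → from (P⇔∈A j)))
  (λ ∣A∣≤k S S⊆P → ≤-trans (p⊆q⇒∣p∣≤∣q∣ (λ {j} j∈S → to (P⇔∈A j) (S⊆P j j∈S))) ∣A∣≤k)

suc∸≤⇔≤∸1 : ∀ {d c t s} → 1 ≤ s → d + c ≡ t → (suc t ∸ d ≤ s ⇔ c ≤ s ∸ 1)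
suc∸≤⇔≤∸1 {d} {c} {s = suc s} _ refl
  rewrite sym (+-suc d c) | m+n∸m≡n d (suc c) = mk⇔ s≤s⁻¹ s≤s

vertexToFin : ∀ {n t} → Vertex n t → Fin (n ^ t)
vertexToFin []       = zero
vertexToFin (x ∷ xs) = combine x (vertexToFin xs)

vertexToFin-injective : ∀ {n t} (x y : Vertex n t) → vertexToFin x ≡ vertexToFin y → x ≡ y
vertexToFin-injective [] [] _ = refl
vertexToFin-injective (x ∷ xs) (y ∷ ys) eq
  with combine-injective x (vertexToFin xs) y (vertexToFin ys) eq
... | x≡y , xs≡ys = cong₂ _∷_ x≡y (vertexToFin-injective xs ys xs≡ys)

injective⇒surjective : ∀ {n} (f : Fin n → Fin n) → (∀ a b → f a ≡ f b → a ≡ b) →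
  ∀ y → ∃ λ x → f x ≡ y
injective⇒surjective {n} f f-inj y
  with pigeonhole (n<1+n n) (λ { zero → y ; (suc x) → f x })
... | zero  , suc x , _       , y≡fx  = x , sym y≡fx
... | suc a , suc b , s≤s a<b , fa≡fb = ⊥-elim (<-irrefl (cong toℕ (f-inj a b fa≡fb)) a<b)

noRepeatedRows⇒surjective : ∀ {n t} (v : ℕ → Vertex n t) → NoRepeatedRows (n ^ t) v →
  ∀ w → ∃ λ i → 1 ≤ i × i ≤ n ^ t × v i ≡ w
noRepeatedRows⇒surjective {n} {t} v noRep w
  with injective⇒surjective code code-injective (vertexToFin w)
  where
  code : Fin (n ^ t) → Fin (n ^ t)
  code k = vertexToFin (v (suc (toℕ k)))
  code-injective : ∀ a b → code a ≡ code b → a ≡ b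
  code-injective a b eq = toℕ-injective (suc-injective
    (noRep _ _ (s≤s z≤n) (toℕ<n a) (s≤s z≤n) (toℕ<n b) (vertexToFin-injective _ _ eq)))
... | k , eq = suc (toℕ k) , s≤s z≤n , toℕ<n k , vertexToFin-injective _ _ eq

module _ {N : ℕ} (f : ℕ → ℕ) (increasing : ∀ i → 1 ≤ i → suc i ≤ N → f i < f (suc i)) where

  increasing-gap : ∀ {i} k → 1 ≤ i → k + i ≤ N → k + f i ≤ f (k + i)
  increasing-gap zero    _   _  = ≤-refl
  increasing-gap {i} (suc k) 1≤i le =
    ≤-trans (s≤s (increasing-gap k 1≤i (≤-trans (n≤1+n _) le)))
            (increasing (k + i) (≤-trans 1≤i (m≤n+m i k)) le)

  increasing-pinned⇒≡id : f 1 ≡ 1 → f N ≤ N → ∀ i → 1 ≤ i → i ≤ N → f i ≡ i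
  increasing-pinned⇒≡id f1≡1 fN≤N (suc i) 1≤i i≤N = ≤-antisym upper lower
    where
    lower : suc i ≤ f (suc i)
    lower = subst₂ _≤_ (trans (cong (i +_) f1≡1) (+-comm i 1)) (cong f (+-comm i 1))
              (increasing-gap i (s≤s z≤n) (subst (_≤ N) (+-comm 1 i) i≤N))
    N≡ : N ∸ suc i + suc i ≡ N
    N≡ = m∸n+n≡m i≤N
    upper : f (suc i) ≤ suc i
    upper = +-cancelˡ-≤ (N ∸ suc i) _ _ (begin
      N ∸ suc i + f (suc i)   ≤⟨ increasing-gap (N ∸ suc i) 1≤i (≤-reflexive N≡) ⟩
      f (N ∸ suc i + suc i)   ≡⟨ cong f N≡ ⟩
      f N                     ≤⟨ fN≤N ⟩
      N                       ≡⟨ sym N≡ ⟩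
      N ∸ suc i + suc i       ∎)
      where open ≤-Reasoning

Separated : ∀ {n t} → ℕ → (ℕ → Vertex n t) → Set
Separated {t = t} N v = ∀ l i → 1 ≤ l → l < i → i ≤ N → suc t ∸ dist (v i) (v l) ≤ i ∸ l

module _ {n t N : ℕ} (v : ℕ → Vertex n t) where

  consecutive-induced⇒≡id : ∀ {L} → IsInduced N v L → IsConsecutive N L →
    ∀ i → 1 ≤ i → i ≤ N → L i ≡ i
  consecutive-induced⇒≡id {L} induced consecutive i 1≤i i≤N =
    increasing-pinned⇒≡id L (λ k 1≤k le → proj₁ (proj₂ induced (suc k) (s≤s 1≤k) le))
      (proj₁ induced) (proj₂ (proj₁ consecutive N (≤-trans 1≤i i≤N) ≤-refl)) i 1≤i i≤N

  consecutiveRadio⇒separated : NoRepeatedRows N v → InducesConsecutiveRadio N v → Separated N v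
  consecutiveRadio⇒separated noRep (L , induced , radio , consecutive) l i 1≤l l<i i≤N =
    subst (suc t ∸ dist (v i) (v l) ≤_) ∣Li-Ll∣≡i∸l (radio i l 1≤i i≤N 1≤l l≤N vi≢vl)
    where
    1≤i = ≤-trans 1≤l (<⇒≤ l<i)
    l≤N = ≤-trans (<⇒≤ l<i) i≤N
    ∣Li-Ll∣≡i∸l : ∣ L i - L l ∣ ≡ i ∸ l
    ∣Li-Ll∣≡i∸l = trans
      (cong₂ ∣_-_∣ (consecutive-induced⇒≡id induced consecutive i 1≤i i≤N)
                   (consecutive-induced⇒≡id induced consecutive l 1≤l l≤N))
      (m≤n⇒∣n-m∣≡n∸m (<⇒≤ l<i))
    vi≢vl : v i ≢ v l
    vi≢vl vi≡vl = <⇒≢ l<i (sym (noRep i l 1≤i i≤N 1≤l l≤N vi≡vl))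

  separated⇒consecutiveRadio : Separated N v → InducesConsecutiveRadio N v
  separated⇒consecutiveRadio separated = (λ i → i) , induced , radio , consecutive
    where
    separated-∣∣ : ∀ l i → 1 ≤ l → l < i → i ≤ N → suc t ∸ dist (v i) (v l) ≤ ∣ i - l ∣
    separated-∣∣ l i 1≤l l<i i≤N =
      subst (suc t ∸ dist (v i) (v l) ≤_) (sym (m≤n⇒∣n-m∣≡n∸m (<⇒≤ l<i)))
        (separated l i 1≤l l<i i≤N)
    induced : IsInduced N v (λ i → i)
    induced = refl , λ { (suc i) (s≤s 1≤i) i≤N →
      ≤-refl , (λ l 1≤l l<i → separated-∣∣ l (suc i) 1≤l l<i i≤N) , (λ _ i<x _ → i<x) }
    radio : IsRadio N v (λ i → i)
    radio i l 1≤i i≤N 1≤l l≤N vi≢vl with <-cmp i l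
    ... | tri< i<l _ _ = subst₂ _≤_ (cong (suc t ∸_) (dist-sym (v l) (v i))) (∣-∣-comm l i)
                           (separated-∣∣ i l 1≤i i<l l≤N)
    ... | tri≈ _ i≡l _ = ⊥-elim (vi≢vl (cong v i≡l))
    ... | tri> _ _ l<i = separated-∣∣ l i 1≤l l<i i≤N
    consecutive : IsConsecutive N (λ i → i)
    consecutive = (λ _ 1≤i i≤N → 1≤i , i≤N) , (λ _ _ _ _ _ _ i≡l → i≡l) ,
                  (λ x 1≤x x≤N → x , 1≤x , x≤N , refl)

orbit-+ : ∀ {n} (σ : ℕ → Perm n) a s k →
  orbit σ (suc a + s) k ≡ orbit σ (suc a) (prod (segment σ (suc (suc a)) s) ⟨$⟩ˡ k)
orbit-+ σ a zero    k rewrite +-identityʳ a = refl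
orbit-+ σ a (suc s) k rewrite +-suc a s     = orbit-+ σ (suc a) s k

orbit-injective : ∀ {n} (σ : ℕ → Perm n) a {x y} → orbit σ a x ≡ orbit σ a y → x ≡ y
orbit-injective σ zero          eq = eq
orbit-injective σ (suc zero)    eq = eq
orbit-injective σ (suc (suc a)) {x} {y} eq = begin
  x                   ≡⟨ inverseʳ π ⟨
  π ⟨$⟩ʳ (π ⟨$⟩ˡ x)   ≡⟨ cong (π ⟨$⟩ʳ_) (orbit-injective σ (suc a) eq) ⟩
  π ⟨$⟩ʳ (π ⟨$⟩ˡ y)   ≡⟨ inverseʳ π ⟩
  y                   ∎
  where
  π = σ (suc (suc a))
  open ≡-Reasoning

length-segment : ∀ {n} (σ : ℕ → Perm n) a s → length (segment σ a s) ≡ s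
length-segment σ a zero    = refl
length-segment σ a (suc s) = cong suc (length-segment σ (suc a) s)

fixedʳ⇒fixedˡ : ∀ {n} (π : Perm n) {x} → π ⟨$⟩ʳ x ≡ x → π ⟨$⟩ˡ x ≡ x
fixedʳ⇒fixedˡ π {x} πx≡x = trans (cong (π ⟨$⟩ˡ_) (sym πx≡x)) (inverseˡ π)

fixedˡ⇒fixedʳ : ∀ {n} (π : Perm n) {x} → π ⟨$⟩ˡ x ≡ x → π ⟨$⟩ʳ x ≡ x
fixedˡ⇒fixedʳ π {x} π⁻¹x≡x = trans (cong (π ⟨$⟩ʳ_) (sym π⁻¹x≡x)) (inverseʳ π)

InΛ⇒fixes-zero : ∀ {m} {Δ : Generator m} {s ρs} π → InΛ Δ s ρs π → π ⟨$⟩ʳ zero ≡ zero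
InΛ⇒fixes-zero _ (_ , _ , _ , π≈prod , prod-fixes) = trans (π≈prod zero) prod-fixes

module _ {m N : ℕ} (Δ : Generator (suc m)) {σ : ℕ → Perm (suc (suc m))}
         (column : IsColumn Δ N σ) where

  column-step : ∀ b → 1 ≤ b → suc b ≤ N → σ (suc b) ∈I Δ (prefix σ b)
  column-step (suc zero)    _ _  = zero , proj₁ (proj₂ column)
  column-step (suc (suc b)) _ le =
    proj₂ (proj₂ column) (suc (suc (suc b))) (s≤s (s≤s (s≤s z≤n))) le

  segment-chain : ∀ a s → 1 ≤ a → a + s ≤ N → Chain Δ (prefix σ a) (segment σ (suc a) s)
  segment-chain a zero    _   _  = tt
  segment-chain a (suc s) 1≤a le =
    column-step a 1≤a (≤-trans (m≤m+n (suc a) s) le′) , segment-chain (suc a) s (s≤s z≤n) le′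
    where
    le′ : suc a + s ≤ N
    le′ = subst (_≤ N) (+-suc a s) le

  φ≡⇔InΛ : ∀ l i → 1 ≤ l → l ≤ i → i ≤ N →
    (φ σ i ≡ φ σ l) ⇔ InΛ Δ (i ∸ l) (prefix σ l) (prod (segment σ (suc l) (i ∸ l)))
  φ≡⇔InΛ (suc a) i _ l≤i i≤N =
    subst (λ x → (φ σ x ≡ φ σ (suc a)) ⇔ InΛ Δ s (prefix σ (suc a)) π) l+s≡i
      (mk⇔ (λ eq → segment σ (suc (suc a)) s , length-segment σ (suc (suc a)) s ,
                   segment-chain (suc a) s (s≤s z≤n) (subst (_≤ N) (sym l+s≡i) i≤N) ,
                   (λ _ → refl) ,
                   fixedˡ⇒fixedʳ π (orbit-injective σ (suc a) (trans (sym (orbit-+ σ a s zero)) eq)))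
           (λ inΛ → trans (orbit-+ σ a s zero)
                      (cong (orbit σ (suc a)) (fixedʳ⇒fixedˡ π (InΛ⇒fixes-zero π inΛ)))))
    where
    s = i ∸ suc a
    π = prod (segment σ (suc (suc a)) s)
    l+s≡i : suc a + s ≡ i
    l+s≡i = m+[n∸m]≡n l≤i

module _ {m t N : ℕ} (Δ : Generator (suc m)) (O′ : Fin t → ℕ → Perm (suc (suc m)))
         (columns : ∀ j → IsColumn Δ N (O′ j)) where

  SegmentInΛ : ℕ → ℕ → Fin t → Set
  SegmentInΛ l s j = InΛ Δ s (prefix (O′ j) l) (prod (segment (O′ j) (suc l) s))

  FewSegmentsInΛ : Set
  FewSegmentsInΛ = ∀ i s → 1 < i → i ≤ N → 1 ≤ s → s < t → s < i →
    AtMost (s ∸ 1) (SegmentInΛ (i ∸ s) s)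

  separation⇔atMost : ∀ l i → 1 ≤ l → l < i → i ≤ N →
    (suc t ∸ dist (Φrow O′ i) (Φrow O′ l) ≤ i ∸ l) ⇔ AtMost (i ∸ l ∸ 1) (SegmentInΛ l (i ∸ l))
  separation⇔atMost l i 1≤l l<i i≤N =
    ⇔-trans (suc∸≤⇔≤∸1 (m<n⇒0<n∸m l<i) (dist+∣agreement∣≡t g h))
            (⇔-sym (atMost⇔∣∣≤ (agreement g h) inΛ⇔∈agreement))
    where
    g h : Fin t → Fin (suc (suc m))
    g j = φ (O′ j) i
    h j = φ (O′ j) l
    inΛ⇔∈agreement : ∀ j → SegmentInΛ l (i ∸ l) j ⇔ j ∈S agreement g h
    inΛ⇔∈agreement j = ⇔-trans (⇔-sym (φ≡⇔InΛ Δ (columns j) l i 1≤l (<⇒≤ l<i) i≤N))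
                               (mk⇔ (≡⇒∈agreement g h j) (∈agreement⇒≡ g h j))

  separated⇒fewSegmentsInΛ : Separated N (Φrow O′) → FewSegmentsInΛ
  separated⇒fewSegmentsInΛ separated i s _ i≤N 1≤s _ s<i =
    subst (λ s → AtMost (s ∸ 1) (SegmentInΛ l s)) (m∸[m∸n]≡n (<⇒≤ s<i))
      (to (separation⇔atMost l i 1≤l l<i i≤N) (separated l i 1≤l l<i i≤N))
    where
    l = i ∸ s
    1≤l = m<n⇒0<n∸m s<i
    l<i = ∸-monoʳ-< {o = 0} 1≤s (<⇒≤ s<i)

  fewSegmentsInΛ⇒separated : NoRepeatedRows N (Φrow O′) → FewSegmentsInΛ →
    Separated N (Φrow O′)
  fewSegmentsInΛ⇒separated noRep few l i 1≤l l<i i≤N with i ∸ l <? t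
  ... | yes s<t = from (separation⇔atMost l i 1≤l l<i i≤N)
    (subst (λ x → AtMost (i ∸ l ∸ 1) (SegmentInΛ x (i ∸ l))) (m∸[m∸n]≡n (<⇒≤ l<i))
      (few i (i ∸ l) (≤-trans (s≤s 1≤l) l<i) i≤N (m<n⇒0<n∸m l<i) s<t
           (∸-monoʳ-< {o = 0} 1≤l (<⇒≤ l<i))))
  ... | no s≮t = ≤-trans (∸-monoʳ-≤ (suc t) 1≤d) (≮⇒≥ s≮t)
    where
    1≤d : 1 ≤ dist (Φrow O′ i) (Φrow O′ l)
    1≤d = n≢0⇒n>0 λ d≡0 → <⇒≢ l<i (sym
      (noRep i l (≤-trans 1≤l (<⇒≤ l<i)) i≤N 1≤l (≤-trans (<⇒≤ l<i) i≤N) (dist≡0⇒≡ _ _ d≡0)))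

corollary31 : (m t : ℕ) → 1 ≤ t →
    (Δ : Generator (suc (suc m))) → RespectsExt Δ →
    (O′ : Fin t → ℕ → Perm (suc (suc (suc m)))) →
    (∀ j → IsColumn Δ (suc (suc (suc m)) ^ t) (O′ j)) →
    (IsOrdering (suc (suc (suc m)) ^ t) (Φrow O′)
      × InducesConsecutiveRadio (suc (suc (suc m)) ^ t) (Φrow O′))
    ⇔
    (NoRepeatedRows (suc (suc (suc m)) ^ t) (Φrow O′)
      × (∀ i s → 1 < i → i ≤ suc (suc (suc m)) ^ t → 1 ≤ s → s < t → s < i →
           AtMost (s ∸ 1) (λ j →
             InΛ Δ s (prefix (O′ j) (i ∸ s)) (prod (segment (O′ j) (suc (i ∸ s)) s)))))
corollary31 m t _ Δ _ O′ columns = mk⇔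
  (λ ((noRep , _) , consecutiveRadio) → noRep ,
     separated⇒fewSegmentsInΛ Δ O′ columns (consecutiveRadio⇒separated v noRep consecutiveRadio))
  (λ (noRep , few) → (noRep , noRepeatedRows⇒surjective v noRep) ,
     separated⇒consecutiveRadio v (fewSegmentsInΛ⇒separated Δ O′ columns noRep few))
  where
  v = Φrow O′
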